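{- Let $G=(V,E)$ be a simple, finite, connected reflective graph, let $x\sim y$ be adjacent vertices and $z\in V$. Then there exist adjacent vertices $x',y'\in B_1(z)$ with $(x,y)\parallel(x',y')$.
   Context: $d$ is the graph distance and $B_1(z)=\{w:d(z,w)\leq1\}$. For adjacent $x\sim y$ let $V_x^y=\{x': d(x',x)<d(x',y)\}$, $V^{xy}=\{z: d(z,x)=d(z,y)\}$. A reflection from $x$ to $y$ is a graph automorphism $\phi$ with $\phi^2=\mathrm{id}$, $\phi(x)=y$, such that the set of edges between $V_x^y$ and $V_y^x$ is exactly $\{(x',\phi(x')):x'\in V_x^y\}$, and $\phi$ fixes every vertex of $V^{xy}$. $G$ is reflective if a reflection from $x$ to $y$ exists for every edge $x\sim y$. For edges $x\sim y$ and $x'\sim y'$ write $(x,y)\parallel(x',y')$ if $x'\in V_x^y$ and $y'\in V_y^x$. -}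

module Defs where

open import Level using (0ℓ)
open import Data.Nat using (ℕ; zero; suc; _≤_; _<_)
open import Data.Fin using (Fin)
open import Data.Product using (Σ; ∃; ∃-syntax; _×_; _,_)
open import Relation.Nullary using (¬_; Dec)
open import Relation.Binary.PropositionalEquality using (_≡_)

record Graph (n : ℕ) : Set₁ where
  field
    Adj    : Fin n → Fin n → Set
    sym    : ∀ {u v} → Adj u v → Adj v u
    irrefl : ∀ {u} → ¬ Adj u u
    adj?   : ∀ u v → Dec (Adj u v)
open Graph public

module _ {n : ℕ} (G : Graph n) where

  data Walk : Fin n → Fin n → ℕ → Set where
    nil  : ∀ {u} → Walk u u 0
    cons : ∀ {u w v k} → Adj G u w → Walk w v k → Walk u v (suc k)

  Connected : Set
  Connected = ∀ u v → ∃[ k ] Walk u v k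

  Dist : Fin n → Fin n → ℕ → Set
  Dist u v k = Walk u v k × (∀ m → Walk u v m → k ≤ m)

  DistLt : Fin n → Fin n → Fin n → Set
  DistLt a b c = ∃[ k ] ∃[ l ] (Dist a b k × Dist a c l × k < l)

  DistEq : Fin n → Fin n → Fin n → Set
  DistEq a b c = ∃[ k ] (Dist a b k × Dist a c k)

  InV : Fin n → Fin n → Fin n → Set
  InV x y x' = DistLt x' x y

  InVeq : Fin n → Fin n → Fin n → Set
  InVeq x y z = DistEq z x y

  InBall1 : Fin n → Fin n → Set
  InBall1 z w = ∃[ k ] (Dist z w k × k ≤ 1)

  IsAutomorphism : (Fin n → Fin n) → Set
  IsAutomorphism φ =
    (∀ u v → φ u ≡ φ v → u ≡ v) ×
    (∀ v → ∃[ u ] φ u ≡ v) ×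
    (∀ u v → Adj G u v → Adj G (φ u) (φ v)) ×
    (∀ u v → Adj G (φ u) (φ v) → Adj G u v)

  IsReflection : Fin n → Fin n → (Fin n → Fin n) → Set
  IsReflection x y φ =
    IsAutomorphism φ ×
    (∀ u → φ (φ u) ≡ u) ×
    φ x ≡ y ×
    (∀ a → InV x y a → Adj G a (φ a) × InV y x (φ a)) ×
    (∀ a b → InV x y a → InV y x b → Adj G a b → b ≡ φ a) ×
    (∀ z → InVeq x y z → φ z ≡ z)

  Reflective : Set
  Reflective = ∀ x y → Adj G x y → Σ (Fin n → Fin n) (IsReflection x y)

  Parallel : Fin n → Fin n → Fin n → Fin n → Set
  Parallel x y x' y' = InV x y x' × InV y x y'

-- If z lies off the bisector V^{xy}, the reflection swapping the two sides of xy moves z to a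
-- neighbour on the other side, and (z, φ z) is the required edge. If z lies on the bisector, it
-- suffices to find a neighbour u of z off the bisector: the reflection fixes z, so φ u is a
-- neighbour of z as well. Such a u is found by induction along a geodesic from z to x. The
-- inductive step rests on the fact that a reflection from w to z matches every vertex of V_z^w
-- with at most one neighbour in V_w^z.
module Submission where

open import Defs
open import Data.Nat using (ℕ; zero; suc; _≤_; _<_; z≤n; s≤s)
open import Data.Nat.Properties using (≤-antisym; <-cmp; <-irrefl; ≤-pred; ≤-refl; ≰⇒>; _≤?_; anyUpTo?)
open import Data.Nat.Induction using (<-rec)
open import Data.Fin using (Fin; _≟_)
open import Data.Fin.Properties using (any?)
open import Data.Product using (_×_; ∃-syntax; _,_; proj₁; proj₂)
open import Data.Sum using (_⊎_; inj₁; inj₂)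
open import Data.Empty using (⊥-elim)
open import Relation.Nullary using (¬_; Dec; yes; no)
open import Relation.Nullary.Decidable using (_×-dec_)
open import Relation.Binary.PropositionalEquality using (_≡_; _≢_; refl; subst)
  renaming (sym to ≡-sym)
open import Relation.Binary using (tri<; tri≈; tri>)

module _ {n : ℕ} (G : Graph n) where

  walk? : ∀ u v k → Dec (Walk G u v k)
  walk? u v zero with u ≟ v
  ... | yes refl = yes nil
  ... | no u≢v   = no λ { nil → u≢v refl }
  walk? u v (suc k) with any? (λ w → adj? G u w ×-dec walk? w v k)
  ... | yes (w , uw , p) = yes (cons uw p)
  ... | no ¬step         = no λ { (cons {w = w} uw p) → ¬step (w , uw , p) }

  shortest-walk : ∀ {u v} k → Walk G u v k → ∃[ j ] Dist G u v j
  shortest-walk {u} {v} = <-rec (λ k → Walk G u v k → ∃[ j ] Dist G u v j) step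
    where
      step : ∀ k → (∀ {j} → j < k → Walk G u v j → ∃[ i ] Dist G u v i) →
             Walk G u v k → ∃[ j ] Dist G u v j
      step k shorter p with anyUpTo? (walk? u v) k
      ... | yes (j , j<k , q) = shorter j<k q
      ... | no ¬below         = k , p , minimal
        where
          minimal : ∀ m → Walk G u v m → k ≤ m
          minimal m q with k ≤? m
          ... | yes k≤m = k≤m
          ... | no k≰m  = ⊥-elim (¬below (m , ≰⇒> k≰m , q))

  dist-exists : Connected G → ∀ u v → ∃[ k ] Dist G u v k
  dist-exists connected u v = shortest-walk _ (proj₂ (connected u v))

  dist-unique : ∀ {u v k l} → Dist G u v k → Dist G u v l → k ≡ l
  dist-unique (p , p-min) (q , q-min) = ≤-antisym (p-min _ q) (q-min _ p)

  dist-refl : ∀ u → Dist G u u 0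
  dist-refl u = nil , λ _ _ → z≤n

  dist-adj : ∀ {u v} → Adj G u v → Dist G u v 1
  dist-adj {u} {v} uv = cons uv nil , minimal
    where
      minimal : ∀ m → Walk G u v m → 1 ≤ m
      minimal zero    nil = ⊥-elim (irrefl G uv)
      minimal (suc m) _   = s≤s z≤n

  dist-two : ∀ {u w v} → u ≢ v → ¬ Adj G u v → Adj G u w → Adj G w v → Dist G u v 2
  dist-two {u} {w} {v} u≢v ¬uv uw wv = cons uw (cons wv nil) , minimal
    where
      minimal : ∀ m → Walk G u v m → 2 ≤ m
      minimal zero          nil          = ⊥-elim (u≢v refl)
      minimal (suc zero)    (cons uv nil) = ⊥-elim (¬uv uv)
      minimal (suc (suc m)) _            = s≤s (s≤s z≤n)

  InV-of-neighbour : ∀ {z w a} → a ≢ z → Adj G z w → Adj G w a → ¬ Adj G z a → InV G w z a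
  InV-of-neighbour a≢z zw wa ¬za =
    1 , 2 , dist-adj (sym G wa) , dist-two a≢z (λ az → ¬za (sym G az)) (sym G wa) (sym G zw) , s≤s (s≤s z≤n)

  geodesic-tail : ∀ {u w v k} → Adj G u w → Walk G w v k →
                  (∀ m → Walk G u v m → suc k ≤ m) → Dist G w v k
  geodesic-tail uw p minimal = p , λ m q → ≤-pred (minimal (suc m) (cons uw q))

  InVeq-sym : ∀ {x y u} → InVeq G x y u → InVeq G y x u
  InVeq-sym (k , ux , uy) = k , uy , ux

  module Reflection {a b : Fin n} {φ : Fin n → Fin n} (ρ : IsReflection G a b φ) where

    injective : ∀ u v → φ u ≡ φ v → u ≡ v
    injective = proj₁ (proj₁ ρ)

    preserves-adj : ∀ u v → Adj G u v → Adj G (φ u) (φ v)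
    preserves-adj = proj₁ (proj₂ (proj₂ (proj₁ ρ)))

    source↦target : φ a ≡ b
    source↦target = proj₁ (proj₂ (proj₂ ρ))

    matches : ∀ u → InV G a b u → Adj G u (φ u) × InV G b a (φ u)
    matches = proj₁ (proj₂ (proj₂ (proj₂ ρ)))

    matches-unique : ∀ u v → InV G a b u → InV G b a v → Adj G u v → v ≡ φ u
    matches-unique = proj₁ (proj₂ (proj₂ (proj₂ (proj₂ ρ))))

    fixes-bisector : ∀ u → InVeq G a b u → φ u ≡ u
    fixes-bisector = proj₂ (proj₂ (proj₂ (proj₂ (proj₂ ρ))))

    image-adj-bisector : ∀ {u v} → InVeq G a b v → Adj G u v → Adj G (φ u) v
    image-adj-bisector {u} {v} v= uv = subst (Adj G (φ u)) (fixes-bisector v v=) (preserves-adj u v uv)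

    partner-unique : ∀ {u u' v} → InV G a b u → InV G a b u' → InV G b a v →
                     Adj G u v → Adj G u' v → u ≡ u'
    partner-unique {u} {u'} {v} u∈ u'∈ v∈ uv u'v =
      injective u u' (subst (_≡ φ u') (matches-unique u v u∈ v∈ uv) (matches-unique u' v u'∈ v∈ u'v))

  module _ (x y : Fin n) where

    OffBisector : Fin n → Set
    OffBisector u = InV G x y u ⊎ InV G y x u

    off-bisector-not-equidistant : ∀ {u} → OffBisector u → ¬ InVeq G x y u
    off-bisector-not-equidistant (inj₁ (k , l , ux , uy , k<l)) (m , ux' , uy')
      with dist-unique ux ux' | dist-unique uy uy'
    ... | refl | refl = <-irrefl refl k<l
    off-bisector-not-equidistant (inj₂ (k , l , uy , ux , k<l)) (m , ux' , uy')
      with dist-unique ux ux' | dist-unique uy uy'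
    ... | refl | refl = <-irrefl refl k<l

    off-bisector-≢ : ∀ {u z} → OffBisector u → InVeq G x y z → u ≢ z
    off-bisector-≢ u-off z= refl = off-bisector-not-equidistant u-off z=

    off-bisector-or-equidistant : Connected G → ∀ u → OffBisector u ⊎ InVeq G x y u
    off-bisector-or-equidistant connected u
      with dist-exists connected u x | dist-exists connected u y
    ... | k , ux | l , uy with <-cmp k l
    ... | tri< k<l _ _    = inj₁ (inj₁ (k , l , ux , uy , k<l))
    ... | tri≈ _ refl _   = inj₂ (k , ux , uy)
    ... | tri> _ _ l<k    = inj₁ (inj₂ (l , k , uy , ux , l<k))

    Crossing : Fin n → Fin n → Set
    Crossing u v = Adj G u v × (Parallel G x y u v ⊎ Parallel G x y v u)

    crossing-off-bisector : ∀ {u v} → Crossing u v → OffBisector v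
    crossing-off-bisector (_ , inj₁ (_ , v∈)) = inj₂ v∈
    crossing-off-bisector (_ , inj₂ (v∈ , _)) = inj₁ v∈

    mirror : Reflective G → Adj G x y → ∀ {u} → OffBisector u →
             ∃[ u' ] (Crossing u u' × (∀ {v} → InVeq G x y v → Adj G u v → Adj G u' v))
    mirror reflective xy {u} (inj₁ u∈) with reflective x y xy
    ... | φ , ρ = φ u , (proj₁ (matches u u∈) , inj₁ (u∈ , proj₂ (matches u u∈))) , image-adj-bisector
      where open Reflection ρ
    mirror reflective xy {u} (inj₂ u∈) with reflective y x (sym G xy)
    ... | ψ , ρ = ψ u , (proj₁ (matches u u∈) , inj₂ (proj₂ (matches u u∈) , u∈)) ,
                  λ v= → image-adj-bisector (InVeq-sym v=)
      where open Reflection ρ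

    crossing-near : ∀ {z u v} → InBall1 G z u → InBall1 G z v → Crossing u v →
                    ∃[ x' ] ∃[ y' ] (InBall1 G z x' × InBall1 G z y' × Adj G x' y' × Parallel G x y x' y')
    crossing-near zu zv (uv , inj₁ parallel) = _ , _ , zu , zv , uv , parallel
    crossing-near zu zv (uv , inj₂ parallel) = _ , _ , zv , zu , sym G uv , parallel

  ball-refl : ∀ z → InBall1 G z z
  ball-refl z = 0 , dist-refl z , z≤n

  ball-adj : ∀ {z u} → Adj G z u → InBall1 G z u
  ball-adj zu = 1 , dist-adj zu , ≤-refl

module _ {n : ℕ} {G : Graph n} (connected : Connected G) (reflective : Reflective G)
         {x y : Fin n} (xy : Adj G x y) where

  -- Unless t, its mirror image t' or σ t (σ the reflection from w to z) is a neighbour of z off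
  -- the bisector, σ t is fixed by the mirror and hence a common neighbour of t, t' ∈ V_w^z in V_z^w.
  bisector-escape-step : ∀ {z w t} → InVeq G x y z → InVeq G x y w → Adj G z w → Adj G w t →
                         OffBisector G x y t → ∃[ u ] (Adj G z u × OffBisector G x y u)
  bisector-escape-step {z} {w} {t} z= w= zw wt t-off with adj? G z t
  ... | yes zt = t , zt , t-off
  ... | no ¬zt with mirror G x y reflective xy t-off
  ... | t' , t'-crossing@(tt' , _) , t'-adj with adj? G z t'
  ... | yes zt' = t' , zt' , crossing-off-bisector G x y t'-crossing
  ... | no ¬zt' with reflective w z (sym G zw)
  ... | σ , ρ = via-σt
    where
      open Reflection G ρ
      t∈ : InV G w z t
      t∈ = InV-of-neighbour G (off-bisector-≢ G x y t-off z=) zw wt ¬zt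
      t'∈ : InV G w z t'
      t'∈ = InV-of-neighbour G (off-bisector-≢ G x y (crossing-off-bisector G x y t'-crossing) z=)
                             zw (sym G (t'-adj w= (sym G wt))) ¬zt'
      t-σt : Adj G t (σ t)
      t-σt = proj₁ (matches t t∈)
      via-σt : ∃[ u ] (Adj G z u × OffBisector G x y u)
      via-σt with off-bisector-or-equidistant G x y connected (σ t)
      ... | inj₁ σt-off = σ t , sym G (subst (Adj G (σ t)) source↦target (preserves-adj t w (sym G wt))) , σt-off
      ... | inj₂ σt= = ⊥-elim (irrefl G (subst (Adj G t) (≡-sym t≡t') tt'))
        where
          t≡t' : t ≡ t'
          t≡t' = partner-unique t∈ t'∈ (proj₂ (matches t t∈)) t-σt (t'-adj σt= t-σt)

  bisector-escape : ∀ k {z} → Dist G z x k → InVeq G x y z → ∃[ u ] (Adj G z u × OffBisector G x y u)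
  bisector-escape zero (nil , _) x= =
    ⊥-elim (off-bisector-not-equidistant G x y (inj₁ (0 , 1 , dist-refl G x , dist-adj G xy , s≤s z≤n)) x=)
  bisector-escape (suc k) (cons {w = w} zw p , minimal) z=
    with off-bisector-or-equidistant G x y connected w
  ... | inj₁ w-off = w , zw , w-off
  ... | inj₂ w= with bisector-escape k (geodesic-tail G zw p minimal) w=
  ... | t , wt , t-off = bisector-escape-step z= w= zw wt t-off

lemma2p4 : (n : ℕ) (G : Graph n) → Connected G → Reflective G →
    (x y : Fin n) → Adj G x y → (z : Fin n) →
    ∃[ x' ] ∃[ y' ] (InBall1 G z x' × InBall1 G z y' × Adj G x' y' × Parallel G x y x' y')
lemma2p4 n G connected reflective x y xy z with off-bisector-or-equidistant G x y connected z
... | inj₁ z-off with mirror G x y reflective xy z-off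
... | z' , crossing , _ = crossing-near G x y (ball-refl G z) (ball-adj G (proj₁ crossing)) crossing
lemma2p4 n G connected reflective x y xy z | inj₂ z=
  with bisector-escape connected reflective xy _ (proj₂ (dist-exists G connected z x)) z=
... | u , zu , u-off with mirror G x y reflective xy u-off
... | u' , crossing , u'-adj =
  crossing-near G x y (ball-adj G zu) (ball-adj G (sym G (u'-adj z= (sym G zu)))) crossing
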